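{- Let $d\ge 1$ and let $k$ be an integer with $3\le k\le d+1$. Then $$k\text{ - }\mathrm{gp_e}(Q_d)=(k-1)2^{d-1}=(k-1)\,\mathrm{gcover_e}(Q_d)=(k-1)\,\mathrm{gpart_e}(Q_d).$$
   Context: $Q_d$ is the $d$-dimensional hypercube: vertex set $\{0,1\}^d$, two vertices adjacent iff they differ in exactly one coordinate. A geodesic is a shortest path. An edge $k$-general position set of a graph $G$ is a set $S\subseteq E(G)$ with $|S\cap E(P)|\le k-1$ for every geodesic $P$; $k\text{ - }\mathrm{gp_e}(G)$ is the maximum size of such a set. $\mathrm{gcover_e}(G)$ is the minimum number of geodesics such that every edge lies on at least one of them; $\mathrm{gpart_e}(G)$ is the minimum number of geodesics such that every edge lies on exactly one of them. -}

module Defs where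

open import Data.Nat using (ℕ; zero; suc; _+_; _*_; _∸_; _^_; _≤_)
open import Data.Bool using (Bool; true; false)
open import Data.Fin using (Fin)
open import Data.Vec using (Vec; lookup; _[_]≔_)
open import Data.List using (List; length)
import Data.List as L
open import Data.List.Relation.Unary.Unique.Propositional using (Unique)
open import Data.List.Membership.Propositional using (_∈_)
open import Data.Product using (Σ; ∃; _×_; _,_)
open import Data.Sum using (_⊎_)
open import Relation.Binary.PropositionalEquality using (_≡_; _≢_)

Vertex : ℕ → Set
Vertex d = Vec Bool d

Adj : ∀ {d} → Vertex d → Vertex d → Set
Adj {d} u v = Σ (Fin d) λ i → (lookup u i ≢ lookup v i)
                × (∀ j → j ≢ i → lookup u j ≡ lookup v j)

-- An edge of Q_d is represented uniquely by its endpoint with a 0 in the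
-- flipped coordinate i, together with i: the edge {v, v[i:=1]}.
record Edge (d : ℕ) : Set where
  constructor edge
  field
    base  : Vertex d
    coord : Fin d
    low   : lookup base coord ≡ false

open Edge public

lo hi : ∀ {d} → Edge d → Vertex d
lo e = base e
hi e = base e [ coord e ]≔ true

data Walk {d : ℕ} : Vertex d → Vertex d → Set where
  [_]    : (v : Vertex d) → Walk v v
  _∷⟨_⟩_ : ∀ {w v} (u : Vertex d) → Adj u w → Walk w v → Walk u v

len : ∀ {d} {u v : Vertex d} → Walk u v → ℕ
len [ _ ]          = 0
len (_ ∷⟨ _ ⟩ P)   = suc (len P)

data OnWalk {d : ℕ} (e : Edge d) : {u v : Vertex d} → Walk u v → Set where
  here  : ∀ {a b v} (adj : Adj a b) (P : Walk b v) →
          ((a ≡ lo e × b ≡ hi e) ⊎ (a ≡ hi e × b ≡ lo e)) →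
          OnWalk e (a ∷⟨ adj ⟩ P)
  there : ∀ {a b v} (adj : Adj a b) {P : Walk b v} →
          OnWalk e P → OnWalk e (a ∷⟨ adj ⟩ P)

record Geodesic (d : ℕ) : Set where
  constructor geodesic
  field
    start  : Vertex d
    end    : Vertex d
    walk   : Walk start end
    shortest : (Q : Walk start end) → len walk ≤ len Q

open Geodesic public

_onGeo_ : ∀ {d} → Edge d → Geodesic d → Set
e onGeo P = OnWalk e (walk P)

-- Edge k-general position set: S (a duplicate-free list of edges) with
-- |S ∩ E(P)| ≤ k - 1 for every geodesic P. |S ∩ E(P)| ≤ k-1 is expressed as:
-- every duplicate-free list of edges lying in S ∩ E(P) has length ≤ k-1.
IsEdgeKGP : (d k : ℕ) → List (Edge d) → Set
IsEdgeKGP d k S = Unique S ×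
  ((P : Geodesic d) (T : List (Edge d)) → Unique T →
     (∀ {e} → e ∈ T → (e ∈ S × e onGeo P)) → length T ≤ k ∸ 1)

IsKGpe : (d k n : ℕ) → Set
IsKGpe d k n =
  (Σ (List (Edge d)) λ S → IsEdgeKGP d k S × length S ≡ n) ×
  ((S : List (Edge d)) → IsEdgeKGP d k S → length S ≤ n)

IsGeoCover : (d : ℕ) → List (Geodesic d) → Set
IsGeoCover d Ps = (e : Edge d) → Σ (Fin (length Ps)) λ j → e onGeo L.lookup Ps j

IsGeoPartition : (d : ℕ) → List (Geodesic d) → Set
IsGeoPartition d Ps = (e : Edge d) → Σ (Fin (length Ps)) λ j →
  (e onGeo L.lookup Ps j) × (∀ j' → e onGeo L.lookup Ps j' → j' ≡ j)

IsGcoverE : (d n : ℕ) → Set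
IsGcoverE d n =
  (Σ (List (Geodesic d)) λ Ps → IsGeoCover d Ps × length Ps ≡ n) ×
  ((Ps : List (Geodesic d)) → IsGeoCover d Ps → n ≤ length Ps)

IsGpartE : (d n : ℕ) → Set
IsGpartE d n =
  (Σ (List (Geodesic d)) λ Ps → IsGeoPartition d Ps × length Ps ≡ n) ×
  ((Ps : List (Geodesic d)) → IsGeoPartition d Ps → n ≤ length Ps)

-- A walk from u to v has at least hamming u v steps, and at least as many steps outside a
-- direction i as u and v have differing coordinates other than i.  Since a geodesic has exactly
-- hamming u v steps, it crosses every direction at most once.  Hence the edges in k − 1 fixed
-- directions form an edge k-general position set of size (k − 1) 2^(d−1), and a geodesic contains
-- at most one of the 2^(d−1) edges in direction 0, so no cover uses fewer geodesics.  Conversely,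
-- the geodesics from the even vertices to their antipodes, flipping the coordinates in increasing
-- order, partition E(Q_d) into 2^(d−1) geodesics, each of which contains at most k − 1 edges of an
-- edge k-general position set.

module Submission where

open import Defs
open import Data.Nat using (ℕ; zero; suc; _+_; _*_; _∸_; _^_; _≤_; _<_; z≤n; s≤s; s≤s⁻¹)
import Data.Nat as ℕ
open import Data.Nat.Properties hiding (_≟_)
open import Algebra.Properties.CommutativeMonoid.Sum +-0-commutativeMonoid
  using (sum; sum-remove; sum-cong-≗; sum-replicate-zero)
open import Data.Bool using (Bool; true; false; not; _xor_; if_then_else_)
import Data.Bool as Bool
open import Data.Bool.Properties
  using (xor-same; xor-assoc; xor-identityʳ; not-¬; not-involutive; not-injective)
open import Data.Fin using (Fin; zero; suc; punchIn; _≟_; toℕ; fromℕ<; inject≤)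
open import Data.Fin.Properties
  using (punchInᵢ≢i; toℕ<n; toℕ-injective; toℕ-fromℕ<; toℕ-inject≤; inject≤-injective)
open import Data.Vec using ([]; _∷_; lookup; insertAt)
import Data.Vec as V
open import Data.Vec.Properties
  using (lookup∘update; ∷-injectiveˡ; ∷-injectiveʳ; insertAt-lookup; removeAt-insertAt)
import Data.Vec.Functional as Vector
open import Data.Product using (Σ; _×_; _,_; proj₁; proj₂)
open import Data.Sum using (_⊎_; inj₁; inj₂)
open import Data.Empty using (⊥; ⊥-elim)
open import Data.List using (List; []; _∷_; _++_; length; filter; allFin)
import Data.List as L
open import Data.List.Properties using (length-++; length-map; length-tabulate)
open import Data.List.Relation.Unary.All using (_∷_)
import Data.List.Relation.Unary.All as All
open import Data.List.Relation.Unary.AllPairs using (_∷_)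
import Data.List.Relation.Unary.AllPairs as AllPairs
open import Data.List.Relation.Unary.Any using (here; there)
import Data.List.Relation.Unary.Any as Any
open import Data.List.Relation.Unary.Any.Properties using (lookup-index)
open import Data.List.Relation.Unary.Unique.Propositional using (Unique)
open import Data.List.Relation.Unary.Unique.Propositional.Properties
  using (filter⁺; map⁺; ++⁺; allFin⁺)
open import Data.List.Membership.Propositional using (_∈_)
open import Data.List.Membership.Propositional.Properties
  using (∈-filter⁻; ∈-lookup; ∈-map⁺; ∈-map⁻; ∈-++⁺ˡ; ∈-++⁺ʳ; ∈-++⁻)
open import Axiom.UniquenessOfIdentityProofs using (module Decidable⇒UIP)
open import Function using (_∘_; id)
open import Relation.Nullary using (¬_; yes; no; does; contradiction)
import Relation.Unary as U
open import Relation.Unary.Properties using (∁?)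
open import Relation.Binary.PropositionalEquality

private variable n : ℕ

-- Counting

AtMost : {A : Set} → ℕ → (A → Set) → Set
AtMost {A} m P = (T : List A) → Unique T → (∀ {x} → x ∈ T → P x) → length T ≤ m

AtMost-mono : {A : Set} {m : ℕ} {P Q : A → Set} → (∀ {x} → Q x → P x) → AtMost m P → AtMost m Q
AtMost-mono Q⇒P atMost T uniq inQ = atMost T uniq (Q⇒P ∘ inQ)

AtMost-1 : {A : Set} {P : A → Set} → (∀ {x y} → P x → P y → x ≡ y) → AtMost 1 P
AtMost-1 same []          _                _   = z≤n
AtMost-1 same (_ ∷ [])    _                _   = s≤s z≤n
AtMost-1 same (_ ∷ _ ∷ _) ((x≢y ∷ _) ∷ _) inP =
  contradiction (same (inP (here refl)) (inP (there (here refl)))) x≢y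

length-filter+filter∁ : {A : Set} {P : A → Set} (P? : U.Decidable P) (xs : List A) →
                        length (filter P? xs) + length (filter (∁? P?) xs) ≡ length xs
length-filter+filter∁ P? []       = refl
length-filter+filter∁ P? (x ∷ xs) with does (P? x)
... | true  = cong suc (length-filter+filter∁ P? xs)
... | false = trans (+-suc _ _) (cong suc (length-filter+filter∁ P? xs))

AtMost-fibres : {A : Set} {P : A → Set} (f : A → ℕ) (N m : ℕ) → (∀ {x} → P x → f x < N) →
                (∀ j → j < N → AtMost m (λ x → P x × f x ≡ j)) → AtMost (N * m) P
AtMost-fibres f zero    m f<N fibre []      _    _   = z≤n
AtMost-fibres f zero    m f<N fibre (x ∷ _) _    inP = contradiction (f<N (inP (here refl))) λ ()
AtMost-fibres f (suc N) m f<N fibre T       uniq inP = begin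
  length T                  ≡⟨ length-filter+filter∁ top? T ⟨
  length top + length rest  ≤⟨ +-mono-≤ top≤m rest≤N*m ⟩
  m + N * m                 ∎
  where
    open ≤-Reasoning
    top? = λ x → f x ℕ.≟ N
    top  = filter top? T
    rest = filter (∁? top?) T
    top≤m : length top ≤ m
    top≤m = fibre N ≤-refl top (filter⁺ top? uniq)
      λ x∈ → let x∈T , fx≡N = ∈-filter⁻ top? x∈ in inP x∈T , fx≡N
    rest≤N*m : length rest ≤ N * m
    rest≤N*m = AtMost-fibres f N m
      (λ (Px , fx≢N) → ≤∧≢⇒< (s≤s⁻¹ (f<N Px)) fx≢N)
      (λ j j<N → AtMost-mono (λ ((Px , _) , fx≡j) → Px , fx≡j) (fibre j (m<n⇒m<1+n j<N)))
      rest (filter⁺ (∁? top?) uniq)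
      (λ x∈ → let x∈T , fx≢N = ∈-filter⁻ (∁? top?) x∈ in inP x∈T , fx≢N)

lookup-injective : {A : Set} {xs : List A} → Unique xs →
                   ∀ i j → L.lookup xs i ≡ L.lookup xs j → i ≡ j
lookup-injective {xs = _ ∷ _} _        zero    zero    _  = refl
lookup-injective {xs = _ ∷ _} (x∉ ∷ _) zero    (suc j) eq = contradiction eq (All.lookup x∉ (∈-lookup j))
lookup-injective {xs = _ ∷ _} (x∉ ∷ _) (suc i) zero    eq = contradiction (sym eq) (All.lookup x∉ (∈-lookup i))
lookup-injective {xs = _ ∷ _} (_ ∷ u)  (suc i) (suc j) eq = cong suc (lookup-injective u i j eq)

-- Weighted Hamming distance and lengths of walks

diff : Bool → Bool → ℕ
diff x y = if x xor y then 1 else 0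

diff≤1 : ∀ x y → diff x y ≤ 1
diff≤1 x y with x xor y
... | false = z≤n
... | true  = s≤s z≤n

diff-self : ∀ x → diff x x ≡ 0
diff-self false = refl
diff-self true  = refl

distance : (Fin n → ℕ) → Vertex n → Vertex n → ℕ
distance ω u v = sum λ c → ω c * diff (lookup u c) (lookup v c)

hamming : Vertex n → Vertex n → ℕ
hamming = distance (λ _ → 1)

cost : (Fin n → ℕ) → {u v : Vertex n} → Walk u v → ℕ
cost ω [ _ ]            = 0
cost ω (_ ∷⟨ j , _ ⟩ W) = ω j + cost ω W

sum-removeAt≤sum : (t : Fin (suc n) → ℕ) (i : Fin (suc n)) → sum (Vector.removeAt t i) ≤ sum t
sum-removeAt≤sum t i = ≤-trans (m≤n+m _ (t i)) (≤-reflexive (sym (sum-remove t)))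

distance-self : (ω : Fin n → ℕ) (v : Vertex n) → distance ω v v ≡ 0
distance-self {n} ω v =
  trans (sum-cong-≗ λ c → trans (cong (ω c *_) (diff-self (lookup v c))) (*-zeroʳ (ω c)))
        (sum-replicate-zero n)

distance-step : (ω : Fin n → ℕ) {u w : Vertex n} (v : Vertex n) (adj : Adj u w) →
                distance ω u v ≤ ω (proj₁ adj) + distance ω w v
distance-step {zero}  ω v (() , _)
distance-step {suc n} ω {u} {w} v (j , _ , agree) = begin
  distance ω u v                               ≡⟨ sum-remove (term u) ⟩
  term u j + sum (Vector.removeAt (term u) j)  ≡⟨ cong (term u j +_) (sum-cong-≗ agree-off-j) ⟩
  term u j + sum (Vector.removeAt (term w) j)  ≤⟨ +-mono-≤ term≤weight (sum-removeAt≤sum (term w) j) ⟩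
  ω j + distance ω w v                         ∎
  where
    open ≤-Reasoning
    term : Vertex (suc n) → Fin (suc n) → ℕ
    term x c = ω c * diff (lookup x c) (lookup v c)
    agree-off-j : ∀ k → term u (punchIn j k) ≡ term w (punchIn j k)
    agree-off-j k = cong (λ b → ω (punchIn j k) * diff b (lookup v (punchIn j k)))
                         (agree (punchIn j k) (punchInᵢ≢i j k))
    term≤weight : term u j ≤ ω j
    term≤weight = ≤-trans (*-monoʳ-≤ (ω j) (diff≤1 (lookup u j) (lookup v j)))
                          (≤-reflexive (*-identityʳ (ω j)))

distance≤cost : (ω : Fin n → ℕ) {u v : Vertex n} (W : Walk u v) → distance ω u v ≤ cost ω W
distance≤cost ω [ v ]                           = ≤-reflexive (distance-self ω v)
distance≤cost ω {v = v} (_∷⟨_⟩_ {w} u adj W) =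
  ≤-trans (distance-step ω {u} {w} v adj) (+-monoʳ-≤ (ω (proj₁ adj)) (distance≤cost ω W))

cost-1≡len : {u v : Vertex n} (W : Walk u v) → cost (λ _ → 1) W ≡ len W
cost-1≡len [ _ ]          = refl
cost-1≡len (_ ∷⟨ _ ⟩ W) = cong suc (cost-1≡len W)

hamming≤len : {u v : Vertex n} (W : Walk u v) → hamming u v ≤ len W
hamming≤len W = ≤-trans (distance≤cost (λ _ → 1) W) (≤-reflexive (cost-1≡len W))

on off : Fin n → Fin n → ℕ
on  i c = if does (c ≟ i) then 1 else 0
off i c = if does (c ≟ i) then 0 else 1

steps : Fin n → {u v : Vertex n} → Walk u v → ℕ
steps i = cost (on i)

on-self : (i : Fin n) → on i i ≡ 1
on-self i with i ≟ i
... | yes _  = refl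
... | no i≢i = contradiction refl i≢i

on-step : {i j : Fin n} {k : ℕ} → j ≡ i → on i j + k ≡ suc k
on-step {i = i} refl = cong (_+ _) (on-self i)

off-punchIn : (i : Fin (suc n)) (k : Fin n) → off i (punchIn i k) ≡ 1
off-punchIn i k with punchIn i k ≟ i
... | yes eq = contradiction eq (punchInᵢ≢i i k)
... | no _   = refl

cost-off+steps : (i : Fin n) {u v : Vertex n} (W : Walk u v) → cost (off i) W + steps i W ≡ len W
cost-off+steps i [ _ ]              = refl
cost-off+steps i (_ ∷⟨ j , _ ⟩ W) with does (j ≟ i)
... | true  = trans (+-suc _ _) (cong suc (cost-off+steps i W))
... | false = cong suc (cost-off+steps i W)

hamming≤1+distance-off : (i : Fin n) (u v : Vertex n) → hamming u v ≤ 1 + distance (off i) u v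
hamming≤1+distance-off {suc n} i u v = begin
  hamming u v                                   ≡⟨ sum-remove (term (λ _ → 1)) ⟩
  term (λ _ → 1) i + sum (Vector.removeAt (term (λ _ → 1)) i)
    ≤⟨ +-mono-≤ (≤-trans (≤-reflexive (*-identityˡ _)) (diff≤1 (lookup u i) (lookup v i)))
                (≤-reflexive (sum-cong-≗ λ k →
                  cong (_* diff (lookup u (punchIn i k)) (lookup v (punchIn i k))) (sym (off-punchIn i k)))) ⟩
  1 + sum (Vector.removeAt (term (off i)) i)    ≤⟨ +-monoʳ-≤ 1 (sum-removeAt≤sum (term (off i)) i) ⟩
  1 + distance (off i) u v                      ∎
  where
    open ≤-Reasoning
    term : (Fin (suc n) → ℕ) → Fin (suc n) → ℕ
    term ω c = ω c * diff (lookup u c) (lookup v c)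

Adj-∷ : ∀ (x : Bool) {xs ys : Vertex n} → Adj xs ys → Adj (x ∷ xs) (x ∷ ys)
Adj-∷ x (i , differ , agree) = suc i , differ , λ { zero _ → refl ; (suc j) j≢i → agree j (j≢i ∘ cong suc) }

Adj-head : ∀ {x y : Bool} (xs : Vertex n) → x ≢ y → Adj (x ∷ xs) (y ∷ xs)
Adj-head xs x≢y = zero , x≢y , λ { zero 0≢0 → contradiction refl 0≢0 ; (suc j) _ → refl }

lift : ∀ (x : Bool) {xs ys : Vertex n} → Walk xs ys → Walk (x ∷ xs) (x ∷ ys)
lift x [ v ]          = [ x ∷ v ]
lift x (u ∷⟨ adj ⟩ W) = (x ∷ u) ∷⟨ Adj-∷ x adj ⟩ lift x W

len-lift : ∀ (x : Bool) {xs ys : Vertex n} (W : Walk xs ys) → len (lift x W) ≡ len W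
len-lift x [ _ ]        = refl
len-lift x (_ ∷⟨ _ ⟩ W) = cong suc (len-lift x W)

hammingWalk : (u v : Vertex n) → Σ (Walk u v) λ W → len W ≡ hamming u v
hammingWalk []       []       = [ [] ] , refl
hammingWalk (x ∷ xs) (y ∷ ys) with hammingWalk xs ys
hammingWalk (false ∷ xs) (false ∷ ys) | W , lenW = lift false W , trans (len-lift false W) lenW
hammingWalk (true  ∷ xs) (true  ∷ ys) | W , lenW = lift true W , trans (len-lift true W) lenW
hammingWalk (false ∷ xs) (true  ∷ ys) | W , lenW =
  (false ∷ xs) ∷⟨ Adj-head xs (λ ()) ⟩ lift true W , cong suc (trans (len-lift true W) lenW)
hammingWalk (true  ∷ xs) (false ∷ ys) | W , lenW =
  (true ∷ xs) ∷⟨ Adj-head xs (λ ()) ⟩ lift false W , cong suc (trans (len-lift false W) lenW)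

-- Geodesics cross every direction at most once

geodesic-len≤hamming : (P : Geodesic n) → len (walk P) ≤ hamming (start P) (end P)
geodesic-len≤hamming P = ≤-trans (shortest P (proj₁ W)) (≤-reflexive (proj₂ W))
  where W = hammingWalk (start P) (end P)

geodesic-steps≤1 : (P : Geodesic n) (i : Fin n) → steps i (walk P) ≤ 1
geodesic-steps≤1 P@(geodesic u v W _) i = +-cancelˡ-≤ (cost (off i) W) _ _ (begin
  cost (off i) W + steps i W   ≡⟨ cost-off+steps i W ⟩
  len W                        ≤⟨ geodesic-len≤hamming P ⟩
  hamming u v                  ≤⟨ hamming≤1+distance-off i u v ⟩
  1 + distance (off i) u v     ≤⟨ +-monoʳ-≤ 1 (distance≤cost (off i) W) ⟩
  1 + cost (off i) W           ≡⟨ +-comm 1 (cost (off i) W) ⟩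
  cost (off i) W + 1           ∎)
  where open ≤-Reasoning

Ends : Edge n → Vertex n → Vertex n → Set
Ends e a b = (a ≡ lo e × b ≡ hi e) ⊎ (a ≡ hi e × b ≡ lo e)

edge-≡ : {e e' : Edge n} → base e ≡ base e' → coord e ≡ coord e' → e ≡ e'
edge-≡ {e = edge b i l} {edge .b .i l'} refl refl =
  cong (edge b i) (Decidable⇒UIP.≡-irrelevant Bool._≟_ l l')

lookup-hi : (e : Edge n) → lookup (hi e) (coord e) ≡ true
lookup-hi e = lookup∘update (coord e) (base e) true

lo≢hi : (e e' : Edge n) → coord e ≡ coord e' → lo e ≢ hi e'
lo≢hi (edge _ i l) e'@(edge _ .i _) refl lo≡hi =
  contradiction (trans (sym l) (trans (cong (λ v → lookup v i) lo≡hi) (lookup-hi e'))) λ ()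

ends-differ : (e : Edge n) {a b : Vertex n} → Ends e a b → lookup a (coord e) ≢ lookup b (coord e)
ends-differ e (inj₁ (refl , refl)) eq = contradiction (trans (sym (low e)) (trans eq (lookup-hi e))) λ ()
ends-differ e (inj₂ (refl , refl)) eq = contradiction (trans (sym (low e)) (trans (sym eq) (lookup-hi e))) λ ()

ends-coord : (e : Edge n) {a b : Vertex n} (adj : Adj a b) → Ends e a b → proj₁ adj ≡ coord e
ends-coord e (j , _ , agree) ends with j ≟ coord e
... | yes j≡i = j≡i
... | no  j≢i = contradiction (agree (coord e) (j≢i ∘ sym)) (ends-differ e ends)

ends-unique : {e e' : Edge n} {a b : Vertex n} (adj : Adj a b) → Ends e a b → Ends e' a b → e ≡ e'
ends-unique {e = e} {e'} adj ends ends' with trans (sym (ends-coord e adj ends)) (ends-coord e' adj ends')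
ends-unique adj (inj₁ (a≡lo , _)) (inj₁ (a≡lo' , _)) | ce = edge-≡ (trans (sym a≡lo) a≡lo') ce
ends-unique adj (inj₂ (_ , b≡lo)) (inj₂ (_ , b≡lo')) | ce = edge-≡ (trans (sym b≡lo) b≡lo') ce
ends-unique {e = e} {e'} adj (inj₁ (a≡lo , _)) (inj₂ (a≡hi , _)) | ce =
  contradiction (trans (sym a≡lo) a≡hi) (lo≢hi e e' ce)
ends-unique {e = e} {e'} adj (inj₂ (_ , b≡lo)) (inj₁ (_ , b≡hi)) | ce =
  contradiction (trans (sym b≡lo) b≡hi) (lo≢hi e e' ce)

onWalk-steps≥1 : {e : Edge n} {u v : Vertex n} {W : Walk u v} → OnWalk e W → 1 ≤ steps (coord e) W
onWalk-steps≥1 {e = e} (here adj _ ends) =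
  ≤-trans (s≤s z≤n) (≤-reflexive (sym (on-step (ends-coord e adj ends))))
onWalk-steps≥1 (there _ on)              = ≤-trans (onWalk-steps≥1 on) (m≤n+m _ _)

onWalk-same-coord : {e e' : Edge n} {u v : Vertex n} {W : Walk u v} → OnWalk e W → OnWalk e' W →
                    coord e ≡ coord e' → e ≡ e' ⊎ 2 ≤ steps (coord e) W
onWalk-same-coord (here adj _ ends) (here .adj _ ends') _ = inj₁ (ends-unique adj ends ends')
onWalk-same-coord {e = e} (here adj W ends) (there .adj on') ce =
  inj₂ (subst (2 ≤_) (sym (on-step (ends-coord e adj ends)))
              (s≤s (subst (λ i → 1 ≤ steps i W) (sym ce) (onWalk-steps≥1 on'))))
onWalk-same-coord {e' = e'} (there adj on) (here .adj W ends') ce =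
  inj₂ (subst (2 ≤_) (sym (on-step (trans (ends-coord e' adj ends') (sym ce)))) (s≤s (onWalk-steps≥1 on)))
onWalk-same-coord (there adj on) (there .adj on') ce with onWalk-same-coord on on' ce
... | inj₁ e≡e' = inj₁ e≡e'
... | inj₂ 2≤   = inj₂ (≤-trans 2≤ (m≤n+m _ _))

onGeo-coord-injective : (P : Geodesic n) {e e' : Edge n} → e onGeo P → e' onGeo P →
                        coord e ≡ coord e' → e ≡ e'
onGeo-coord-injective P {e} on on' ce with onWalk-same-coord on on' ce
... | inj₁ e≡e' = e≡e'
... | inj₂ 2≤   = contradiction (≤-trans 2≤ (geodesic-steps≤1 P (coord e))) λ { (s≤s ()) }

geodesic-AtMost-below : ∀ {d} (m : ℕ) (P : Geodesic d) → AtMost m (λ e → toℕ (coord e) < m × e onGeo P)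
geodesic-AtMost-below m P = subst (λ m' → AtMost m' OnBelow) (*-identityʳ m)
  (AtMost-fibres {P = OnBelow} (toℕ ∘ coord) m 1 proj₁ λ j _ →
    AtMost-1 λ ((_ , onP) , coord≡j) ((_ , onP') , coord'≡j) →
      onGeo-coord-injective P onP onP' (toℕ-injective (trans coord≡j (sym coord'≡j))))
  where OnBelow = λ e → toℕ (coord e) < m × e onGeo P

-- Enumerating vertices and edges

vertices : (n : ℕ) → List (Vertex n)
vertices zero    = L.[ [] ]
vertices (suc n) = L.map (false ∷_) (vertices n) ++ L.map (true ∷_) (vertices n)

vertices-unique : (n : ℕ) → Unique (vertices n)
vertices-unique zero    = All.[] ∷ AllPairs.[]
vertices-unique (suc n) =
  ++⁺ (map⁺ ∷-injectiveʳ (vertices-unique n)) (map⁺ ∷-injectiveʳ (vertices-unique n)) disjoint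
  where
    disjoint : ∀ {v} → ¬ (v ∈ L.map (false ∷_) (vertices n) × v ∈ L.map (true ∷_) (vertices n))
    disjoint (v∈₀ , v∈₁) with ∈-map⁻ (false ∷_) v∈₀ | ∈-map⁻ (true ∷_) v∈₁
    ... | _ , _ , refl | _ , _ , v≡ = contradiction (∷-injectiveˡ v≡) λ ()

∈-vertices : (v : Vertex n) → v ∈ vertices n
∈-vertices []          = here refl
∈-vertices (false ∷ v) = ∈-++⁺ˡ (∈-map⁺ (false ∷_) (∈-vertices v))
∈-vertices (true  ∷ v) = ∈-++⁺ʳ _ (∈-map⁺ (true ∷_) (∈-vertices v))

length-vertices : (n : ℕ) → length (vertices n) ≡ 2 ^ n
length-vertices zero    = refl
length-vertices (suc n) = begin
  length (L.map (false ∷_) (vertices n) ++ L.map (true ∷_) (vertices n))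
    ≡⟨ length-++ (L.map (false ∷_) (vertices n)) ⟩
  length (L.map (false ∷_) (vertices n)) + length (L.map (true ∷_) (vertices n))
    ≡⟨ cong₂ _+_ (length-map (false ∷_) (vertices n)) (length-map (true ∷_) (vertices n)) ⟩
  length (vertices n) + length (vertices n)
    ≡⟨ cong (λ m → m + m) (length-vertices n) ⟩
  2 ^ n + 2 ^ n
    ≡⟨ cong (2 ^ n +_) (+-identityʳ (2 ^ n)) ⟨
  2 ^ suc n ∎
  where open ≡-Reasoning

edgeAlong : Fin (suc n) → Vertex n → Edge (suc n)
edgeAlong i w = edge (insertAt w i false) i (insertAt-lookup w i false)

edgesAlong : Fin (suc n) → List (Edge (suc n))
edgesAlong i = L.map (edgeAlong i) (vertices _)

edgesAlong-coord : {i : Fin (suc n)} {e : Edge (suc n)} → e ∈ edgesAlong i → coord e ≡ i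
edgesAlong-coord {i = i} e∈ with ∈-map⁻ (edgeAlong i) e∈
... | _ , _ , refl = refl

edgesAlong-unique : (i : Fin (suc n)) → Unique (edgesAlong i)
edgesAlong-unique {n} i = map⁺ edgeAlong-injective (vertices-unique n)
  where
    edgeAlong-injective : ∀ {w w'} → edgeAlong i w ≡ edgeAlong i w' → w ≡ w'
    edgeAlong-injective {w} {w'} eq = begin
      w                                   ≡⟨ removeAt-insertAt w i false ⟨
      V.removeAt (insertAt w i false) i   ≡⟨ cong (λ e → V.removeAt (base e) i) eq ⟩
      V.removeAt (insertAt w' i false) i  ≡⟨ removeAt-insertAt w' i false ⟩
      w'                                  ∎
      where open ≡-Reasoning

length-edgesAlong : (i : Fin (suc n)) → length (edgesAlong i) ≡ 2 ^ n
length-edgesAlong {n} i = trans (length-map (edgeAlong i) (vertices n)) (length-vertices n)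

edgesAlongAny : List (Fin (suc n)) → List (Edge (suc n))
edgesAlongAny []       = []
edgesAlongAny (i ∷ is) = edgesAlong i ++ edgesAlongAny is

edgesAlongAny-coord : (is : List (Fin (suc n))) {e : Edge (suc n)} → e ∈ edgesAlongAny is → coord e ∈ is
edgesAlongAny-coord (i ∷ is) e∈ with ∈-++⁻ (edgesAlong i) e∈
... | inj₁ e∈i  = here (edgesAlong-coord e∈i)
... | inj₂ e∈is = there (edgesAlongAny-coord is e∈is)

edgesAlongAny-unique : {is : List (Fin (suc n))} → Unique is → Unique (edgesAlongAny is)
edgesAlongAny-unique {is = []}     _           = AllPairs.[]
edgesAlongAny-unique {is = i ∷ is} (i∉ ∷ uniq) =
  ++⁺ (edgesAlong-unique i) (edgesAlongAny-unique uniq)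
      λ (e∈i , e∈is) → All.lookup i∉ (edgesAlongAny-coord is e∈is) (sym (edgesAlong-coord e∈i))

length-edgesAlongAny : (is : List (Fin (suc n))) → length (edgesAlongAny is) ≡ length is * 2 ^ n
length-edgesAlongAny []       = refl
length-edgesAlongAny (i ∷ is) =
  trans (length-++ (edgesAlong i)) (cong₂ _+_ (length-edgesAlong i) (length-edgesAlongAny is))

initialFins : ∀ {m n} → m ≤ n → List (Fin n)
initialFins {m} m≤n = L.map (λ j → inject≤ j m≤n) (allFin m)

initialFins-below : ∀ {m n} (m≤n : m ≤ n) {i : Fin n} → i ∈ initialFins m≤n → toℕ i < m
initialFins-below m≤n i∈ with ∈-map⁻ (λ j → inject≤ j m≤n) i∈
... | j , _ , refl = subst (_< _) (sym (toℕ-inject≤ j m≤n)) (toℕ<n j)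

initialFins-unique : ∀ {m n} (m≤n : m ≤ n) → Unique (initialFins m≤n)
initialFins-unique {m} m≤n = map⁺ (inject≤-injective m≤n m≤n _ _) (allFin⁺ m)

length-initialFins : ∀ {m n} (m≤n : m ≤ n) → length (initialFins m≤n) ≡ m
length-initialFins {m} m≤n = trans (length-map _ (allFin m)) (length-tabulate id)

edgesBelow : ∀ {m} → m ≤ suc n → List (Edge (suc n))
edgesBelow m≤d = edgesAlongAny (initialFins m≤d)

length-edgesBelow : ∀ {m} (m≤d : m ≤ suc n) → length (edgesBelow m≤d) ≡ m * 2 ^ n
length-edgesBelow m≤d =
  trans (length-edgesAlongAny (initialFins m≤d)) (cong (_* _) (length-initialFins m≤d))

-- Antipodal geodesics

antipode : Vertex n → Vertex n
antipode = V.map not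

antipodalWalk : (v : Vertex n) → Walk v (antipode v)
antipodalWalk []       = [ [] ]
antipodalWalk (x ∷ xs) = (x ∷ xs) ∷⟨ Adj-head xs (not-¬ refl) ⟩ lift (not x) (antipodalWalk xs)

len-antipodalWalk : (v : Vertex n) → len (antipodalWalk v) ≡ n
len-antipodalWalk []       = refl
len-antipodalWalk (x ∷ xs) =
  cong suc (trans (len-lift (not x) (antipodalWalk xs)) (len-antipodalWalk xs))

hamming-antipode : (v : Vertex n) → hamming v (antipode v) ≡ n
hamming-antipode []           = refl
hamming-antipode (false ∷ xs) = cong suc (hamming-antipode xs)
hamming-antipode (true  ∷ xs) = cong suc (hamming-antipode xs)

antipodal : Vertex n → Geodesic n
antipodal v = geodesic v (antipode v) (antipodalWalk v) λ Q → begin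
  len (antipodalWalk v)   ≡⟨ trans (len-antipodalWalk v) (sym (hamming-antipode v)) ⟩
  hamming v (antipode v)  ≤⟨ hamming≤len Q ⟩
  len Q                   ∎
  where open ≤-Reasoning

-- The antipodal walk from v flips the coordinates in increasing order, so it traverses the edge
-- with base b in direction i iff b agrees with the antipode of v before i and with v after i.
OnAntipodal : Edge n → Vertex n → Set
OnAntipodal (edge (_ ∷ bs) zero    _) (_ ∷ xs) = xs ≡ bs
OnAntipodal (edge (b ∷ bs) (suc i) l) (x ∷ xs) = b ≡ not x × OnAntipodal (edge bs i l) xs

onLift⁺ : ∀ (x : Bool) {xs ys : Vertex n} {W : Walk xs ys} {e : Edge n} → OnWalk e W →
          OnWalk (edge (x ∷ base e) (suc (coord e)) (low e)) (lift x W)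
onLift⁺ x (here adj W (inj₁ (a≡lo , b≡hi))) =
  here (Adj-∷ x adj) (lift x W) (inj₁ (cong (x ∷_) a≡lo , cong (x ∷_) b≡hi))
onLift⁺ x (here adj W (inj₂ (a≡hi , b≡lo))) =
  here (Adj-∷ x adj) (lift x W) (inj₂ (cong (x ∷_) a≡hi , cong (x ∷_) b≡lo))
onLift⁺ x (there adj on) = there (Adj-∷ x adj) (onLift⁺ x on)

OnLift : Bool → Edge (suc n) → {xs ys : Vertex n} → Walk xs ys → Set
OnLift x (edge (_ ∷ _)  zero    _) W = ⊥
OnLift x (edge (c ∷ cs) (suc i) l) W = c ≡ x × OnWalk (edge cs i l) W

onLift⁻ : ∀ (x : Bool) {xs ys : Vertex n} (W : Walk xs ys) (e : Edge (suc n)) →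
          OnWalk e (lift x W) → OnLift x e W
onLift⁻ x [ _ ] e ()
onLift⁻ x (_ ∷⟨ adj ⟩ W) (edge (c ∷ cs) zero l) (here _ _ (inj₁ (a≡lo , b≡hi))) =
  contradiction (trans (sym (∷-injectiveˡ b≡hi)) (trans (∷-injectiveˡ a≡lo) l)) λ ()
onLift⁻ x (_ ∷⟨ adj ⟩ W) (edge (c ∷ cs) zero l) (here _ _ (inj₂ (a≡hi , b≡lo))) =
  contradiction (trans (sym (∷-injectiveˡ a≡hi)) (trans (∷-injectiveˡ b≡lo) l)) λ ()
onLift⁻ x (_ ∷⟨ adj ⟩ W) (edge (c ∷ cs) (suc i) l) (here _ _ (inj₁ (a≡lo , b≡hi))) =
  sym (∷-injectiveˡ a≡lo) , here adj W (inj₁ (∷-injectiveʳ a≡lo , ∷-injectiveʳ b≡hi))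
onLift⁻ x (_ ∷⟨ adj ⟩ W) (edge (c ∷ cs) (suc i) l) (here _ _ (inj₂ (a≡hi , b≡lo))) =
  sym (∷-injectiveˡ b≡lo) , here adj W (inj₂ (∷-injectiveʳ a≡hi , ∷-injectiveʳ b≡lo))
onLift⁻ x (_ ∷⟨ adj ⟩ W) (edge (c ∷ cs) zero    l) (there _ on) = onLift⁻ x W _ on
onLift⁻ x (_ ∷⟨ adj ⟩ W) (edge (c ∷ cs) (suc i) l) (there _ on) with onLift⁻ x W _ on
... | c≡x , on' = c≡x , there adj on'

onAntipodal⁺ : (v : Vertex n) (e : Edge n) → OnAntipodal e v → e onGeo antipodal v
onAntipodal⁺ (false ∷ xs) (edge (.false ∷ .xs) zero refl) refl = here _ _ (inj₁ (refl , refl))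
onAntipodal⁺ (true  ∷ xs) (edge (.false ∷ .xs) zero refl) refl = here _ _ (inj₂ (refl , refl))
onAntipodal⁺ (x ∷ xs) (edge (.(not x) ∷ bs) (suc i) l) (refl , on) =
  there _ (onLift⁺ (not x) (onAntipodal⁺ xs (edge bs i l) on))

onAntipodal⁻ : (v : Vertex n) (e : Edge n) → e onGeo antipodal v → OnAntipodal e v
onAntipodal⁻ (x ∷ xs) (edge (c ∷ cs) zero l) (here _ _ (inj₁ (_ , b≡hi))) = ∷-injectiveʳ b≡hi
onAntipodal⁻ (x ∷ xs) (edge (c ∷ cs) zero l) (here _ _ (inj₂ (_ , b≡lo))) = ∷-injectiveʳ b≡lo
onAntipodal⁻ (x ∷ xs) (edge (c ∷ cs) (suc i) l) (here _ _ (inj₁ (a≡lo , b≡hi))) =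
  contradiction (trans (∷-injectiveˡ a≡lo) (sym (∷-injectiveˡ b≡hi))) (not-¬ refl)
onAntipodal⁻ (x ∷ xs) (edge (c ∷ cs) (suc i) l) (here _ _ (inj₂ (a≡hi , b≡lo))) =
  contradiction (trans (∷-injectiveˡ a≡hi) (sym (∷-injectiveˡ b≡lo))) (not-¬ refl)
onAntipodal⁻ (x ∷ xs) (edge (c ∷ cs) zero    l) (there _ on) =
  ⊥-elim (onLift⁻ (not x) (antipodalWalk xs) _ on)
onAntipodal⁻ (x ∷ xs) (edge (c ∷ cs) (suc i) l) (there _ on) with onLift⁻ (not x) (antipodalWalk xs) _ on
... | c≡¬x , on' = c≡¬x , onAntipodal⁻ xs (edge cs i l) on'

parity : Vertex n → Bool
parity []       = false
parity (x ∷ xs) = x xor parity xs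

xor-xorʳ : ∀ x q → (x xor q) xor q ≡ x
xor-xorʳ x q = trans (xor-assoc x q q) (trans (cong (x xor_) (xor-same q)) (xor-identityʳ x))

xor-xorˡ : ∀ x q → x xor (x xor q) ≡ q
xor-xorˡ x q = trans (sym (xor-assoc x x q)) (cong (_xor q) (xor-same x))

-- Exactly two antipodal walks traverse a given edge, and their starting vertices differ only in
-- the direction of the edge; the parity of the starting vertex tells them apart.
onAntipodal-exists : (e : Edge n) (p : Bool) → Σ (Vertex n) λ v → OnAntipodal e v × parity v ≡ p
onAntipodal-exists (edge (_ ∷ bs) zero _) p = (p xor parity bs) ∷ bs , refl , xor-xorʳ p (parity bs)
onAntipodal-exists (edge (b ∷ bs) (suc i) l) p with onAntipodal-exists (edge bs i l) (not b xor p)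
... | xs , on , parity≡ =
  not b ∷ xs , (sym (not-involutive b) , on) , trans (cong (not b xor_) parity≡) (xor-xorˡ (not b) p)

onAntipodal-unique : (e : Edge n) {v v' : Vertex n} → OnAntipodal e v → OnAntipodal e v' →
                     parity v ≡ parity v' → v ≡ v'
onAntipodal-unique (edge (_ ∷ bs) zero _) {x ∷ _} {x' ∷ _} refl refl parity≡ =
  cong (_∷ bs) (begin
    x                                 ≡⟨ xor-xorʳ x (parity bs) ⟨
    (x xor parity bs) xor parity bs   ≡⟨ cong (_xor parity bs) parity≡ ⟩
    (x' xor parity bs) xor parity bs  ≡⟨ xor-xorʳ x' (parity bs) ⟩
    x'                                ∎)
  where open ≡-Reasoning
onAntipodal-unique (edge (b ∷ bs) (suc i) l) {x ∷ xs} {x' ∷ xs'} (b≡¬x , on) (b≡¬x' , on') parity≡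
  with not-injective (trans (sym b≡¬x) b≡¬x')
... | refl = cong (x ∷_) (onAntipodal-unique (edge bs i l) on on'
               (trans (sym (xor-xorˡ x (parity xs))) (trans (cong (x xor_) parity≡) (xor-xorˡ x (parity xs')))))

evenVertices : (n : ℕ) → List (Vertex (suc n))
evenVertices n = L.map (λ w → parity w ∷ w) (vertices n)

evenVertices-parity : {v : Vertex (suc n)} → v ∈ evenVertices n → parity v ≡ false
evenVertices-parity v∈ with ∈-map⁻ (λ w → parity w ∷ w) v∈
... | w , _ , refl = xor-same (parity w)

∈-evenVertices : (v : Vertex (suc n)) → parity v ≡ false → v ∈ evenVertices n
∈-evenVertices (x ∷ w) even = subst (λ y → y ∷ w ∈ evenVertices _) (sym x≡parity)
                                    (∈-map⁺ (λ w → parity w ∷ w) (∈-vertices w))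
  where
    x≡parity : x ≡ parity w
    x≡parity = trans (sym (xor-xorʳ x (parity w))) (cong (_xor parity w) even)

antipodals : (n : ℕ) → List (Geodesic (suc n))
antipodals n = L.map antipodal (evenVertices n)

length-antipodals : (n : ℕ) → length (antipodals n) ≡ 2 ^ n
length-antipodals n = trans (length-map antipodal (evenVertices n))
                            (trans (length-map _ (vertices n)) (length-vertices n))

antipodals-unique : (n : ℕ) → Unique (antipodals n)
antipodals-unique n = map⁺ (cong start) (map⁺ ∷-injectiveʳ (vertices-unique n))

isGeoPartition : ∀ {d} (Ps : List (Geodesic d)) → Unique Ps →
                 (∀ e → Σ (Geodesic d) λ P → P ∈ Ps × e onGeo P) →
                 (∀ {e P Q} → P ∈ Ps → Q ∈ Ps → e onGeo P → e onGeo Q → P ≡ Q) →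
                 IsGeoPartition d Ps
isGeoPartition Ps uniq covered disjoint e with covered e
... | P , P∈ , onP = Any.index P∈ , subst (e onGeo_) (lookup-index P∈) onP , λ j onPj →
  lookup-injective uniq j (Any.index P∈) (trans (disjoint (∈-lookup j) P∈ onPj onP) (lookup-index P∈))

antipodals-partition : (n : ℕ) → IsGeoPartition (suc n) (antipodals n)
antipodals-partition n = isGeoPartition (antipodals n) (antipodals-unique n) covered disjoint
  where
    covered : ∀ e → Σ (Geodesic (suc n)) λ P → P ∈ antipodals n × e onGeo P
    covered e with onAntipodal-exists e false
    ... | v , on , even = antipodal v , ∈-map⁺ antipodal (∈-evenVertices v even) , onAntipodal⁺ v e on
    disjoint : ∀ {e P Q} → P ∈ antipodals n → Q ∈ antipodals n → e onGeo P → e onGeo Q → P ≡ Q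
    disjoint {e} P∈ Q∈ onP onQ with ∈-map⁻ antipodal P∈ | ∈-map⁻ antipodal Q∈
    ... | v , v∈ , refl | v' , v'∈ , refl = cong antipodal (onAntipodal-unique e
          (onAntipodal⁻ v e onP) (onAntipodal⁻ v' e onQ)
          (trans (evenVertices-parity v∈) (sym (evenVertices-parity v'∈))))

partition→cover : ∀ {d} (Ps : List (Geodesic d)) → IsGeoPartition d Ps → IsGeoCover d Ps
partition→cover _ part e = proj₁ (part e) , proj₁ (proj₂ (part e))

cover-AtMost : ∀ {d m} {P : Edge d → Set} (Qs : List (Geodesic d)) → IsGeoCover d Qs →
               (∀ Q → AtMost m (λ e → P e × e onGeo Q)) → AtMost (length Qs * m) P
cover-AtMost {m = m} Qs cover atMost = AtMost-fibres index (length Qs) m (λ _ → toℕ<n _) fibre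
  where
    index = λ e → toℕ (proj₁ (cover e))
    fibre : ∀ j (j<N : j < length Qs) → AtMost m _
    fibre j j<N = AtMost-mono (λ {e} (Pe , index≡j) → Pe ,
      subst (λ i → e onGeo L.lookup Qs i) (toℕ-injective (trans index≡j (sym (toℕ-fromℕ< j<N))))
            (proj₂ (cover e)))
      (atMost (L.lookup Qs (fromℕ< j<N)))

cover-length≥ : (Qs : List (Geodesic (suc n))) → IsGeoCover (suc n) Qs → 2 ^ n ≤ length Qs
cover-length≥ {n} Qs cover = begin
  2 ^ n          ≡⟨ length-edgesAlong {n} zero ⟨
  length E₀      ≤⟨ cover-AtMost {P = _∈ E₀} Qs cover atMost1 E₀ (edgesAlong-unique zero) id ⟩
  length Qs * 1  ≡⟨ *-identityʳ (length Qs) ⟩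
  length Qs      ∎
  where
    open ≤-Reasoning
    E₀ = edgesAlong {n} zero
    atMost1 : ∀ Q → AtMost 1 (λ e → e ∈ E₀ × e onGeo Q)
    atMost1 Q = AtMost-1 λ (e∈ , onQ) (e'∈ , onQ') →
      onGeo-coord-injective Q onQ onQ' (trans (edgesAlong-coord e∈) (sym (edgesAlong-coord e'∈)))

kgp-length≤ : (k : ℕ) (S : List (Edge (suc n))) → IsEdgeKGP (suc n) k S →
              length S ≤ (k ∸ 1) * 2 ^ n
kgp-length≤ {n} k S (uniq , atMost) = begin
  length S                         ≤⟨ cover-AtMost {P = _∈ S} (antipodals n) antipodals-cover atMost S uniq id ⟩
  length (antipodals n) * (k ∸ 1)  ≡⟨ cong (_* (k ∸ 1)) (length-antipodals n) ⟩
  2 ^ n * (k ∸ 1)                  ≡⟨ *-comm (2 ^ n) (k ∸ 1) ⟩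
  (k ∸ 1) * 2 ^ n                  ∎
  where
    open ≤-Reasoning
    antipodals-cover = partition→cover (antipodals n) (antipodals-partition n)

edgesBelow-kgp : (k : ℕ) (k-1≤d : k ∸ 1 ≤ suc n) → IsEdgeKGP (suc n) k (edgesBelow k-1≤d)
edgesBelow-kgp k k-1≤d = edgesAlongAny-unique (initialFins-unique k-1≤d) , λ P →
  AtMost-mono (λ (e∈ , onP) → initialFins-below k-1≤d (edgesAlongAny-coord _ e∈) , onP)
              (geodesic-AtMost-below (k ∸ 1) P)

theorem4p2 : (d k : ℕ) → 1 ≤ d → 3 ≤ k → k ≤ d + 1 →
    IsKGpe d k ((k ∸ 1) * 2 ^ (d ∸ 1)) × IsGcoverE d (2 ^ (d ∸ 1)) × IsGpartE d (2 ^ (d ∸ 1))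
theorem4p2 (suc n) k _ _ k≤d+1 =
  ((edgesBelow k-1≤d , edgesBelow-kgp k k-1≤d , length-edgesBelow k-1≤d) , kgp-length≤ k) ,
  ((antipodals n , antipodals-cover , length-antipodals n) , cover-length≥) ,
  ((antipodals n , antipodals-partition n , length-antipodals n) , λ Ps → cover-length≥ Ps ∘ partition→cover Ps)
  where
    antipodals-cover = partition→cover (antipodals n) (antipodals-partition n)
    k-1≤d : k ∸ 1 ≤ suc n
    k-1≤d = subst (k ∸ 1 ≤_) (m+n∸n≡m (suc n) 1) (∸-monoˡ-≤ 1 k≤d+1)
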